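{- Let $a,b\geq 0$ be integers. Let $A$ be the set of injective maps $f\colon[a]\to[a+b]$ satisfying: for all $i,j\in[a]$, if $f(i)=f(j)+1$ then $i>j$. Let $B$ be the set of all maps $g\colon[a]\to[b]\cup\{0\}$. Then the map $A\to B$, $f\mapsto g_f$, where $g_f(i)=\big|[f(i)]\setminus f([a])\big|$ (the number of elements of $\{1,\dots,f(i)\}$ not in the image of $f$), is a bijection. In particular, $|A|=(b+1)^a$.
   Context: For a nonnegative integer $m$, $[m]=\{1,\dots,m\}$ (with $[0]=\varnothing$). -}

module Defs where

open import Data.Nat using (ℕ; suc; _+_; _≤_; _<_; _≤?_)
open import Data.Fin using (Fin; toℕ; _≟_)
open import Data.Fin.Properties using (any?)
open import Data.List using (List; length; filter; allFin)
open import Data.Product using (_×_; ∃)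
open import Relation.Binary.PropositionalEquality using (_≡_)
open import Relation.Nullary using (¬_)
open import Relation.Nullary.Decidable using (_×-dec_; ¬?)

-- Convention: [m] = {1,…,m} is represented by Fin m, with i : Fin m standing
-- for the number toℕ i + 1.  Since this shift is uniform, comparisons and the
-- relation "f(i) = f(j) + 1" are unaffected.

InjectiveMap : ∀ {a n} → (Fin a → Fin n) → Set
InjectiveMap f = ∀ i j → f i ≡ f j → i ≡ j

NoAscentCondition : ∀ {a n} → (Fin a → Fin n) → Set
NoAscentCondition f = ∀ i j → toℕ (f i) ≡ suc (toℕ (f j)) → toℕ j < toℕ i

InA : (a b : ℕ) → (Fin a → Fin (a + b)) → Set
InA a b f = InjectiveMap f × NoAscentCondition f

InImage : ∀ {a n} → (Fin a → Fin n) → Fin n → Set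
InImage f k = ∃ λ j → f j ≡ k

gMap : ∀ {a n} → (Fin a → Fin n) → Fin a → ℕ
gMap {a} {n} f i =
  length (filter (λ k → (toℕ k ≤? toℕ (f i)) ×-dec ¬? (any? (λ j → f j ≟ k))) (allFin n))

-- For injective f the interval [f(i)] consists of the g_f(i) gaps below f(i) and of the
-- values f(j) ≤ f(i), so f(i) = g_f(i) + #{j | f(j) ≤ f(i)}.  Under the no-ascent
-- condition the values f(j) are ordered like the pairs (g_f(j), j) lexicographically:
-- g_f is monotone in f, and along a run of consecutive values with equal g_f there are
-- no gaps, so no ascent forces the indices to increase.  Hence f(i) = g(i) + rank(i),
-- where rank is taken in the lexicographic order of (g(j), j); this recovers f from
-- g = g_f, and conversely for every g the same formula defines a member of A with
-- g_f = g.  At most b values of [a + b] miss the image, whence g_f(i) ≤ b.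
module Submission where

open import Defs
open import Level using (Level; 0ℓ)
open import Data.Nat
  using (ℕ; zero; suc; pred; _+_; _≤_; _<_; _≤?_; _<?_; z≤n; s≤s; s≤s⁻¹; z<s; >-nonZero)
open import Data.Nat.Properties
  using ( ≤-refl; ≤-trans; ≤-antisym; ≤-total; ≤-reflexive; <-trans; <-irrefl; <-asym; <-cmp
        ; <-≤-trans; ≤-<-trans; <⇒≤; <⇒≢; <⇒≱; ≤⇒≯; ≮⇒≥; ≤∧≢⇒<; 1+n≰n; n≤1+n; m≤n+m
        ; m≤n⇒m<n∨m≡n; m≤n⇒∃[o]m+o≡n; +-comm; +-suc; +-mono-≤; +-mono-≤-<
        ; +-cancelˡ-≡; +-cancelʳ-≡; suc-injective; suc-pred )
import Data.Nat.Properties as ℕ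
open import Data.Fin using (Fin; zero; suc; toℕ; fromℕ<; _≟_)
open import Data.Fin.Properties using (any?; toℕ-injective; toℕ<n; toℕ-fromℕ<; 0≢1+n)
import Data.Fin.Properties as Fin
open import Data.List using (length; filter; tabulate)
open import Data.Bool using (true; false; if_then_else_)
open import Data.Bool.Properties using (∧-zeroʳ)
open import Data.Product using (_×_; _,_; proj₁; proj₂; ∃)
open import Data.Product.Relation.Binary.Lex.Strict
  using (×-Lex; ×-transitive; ×-antisymmetric; ×-total₂; ×-decidable)
open import Data.Product.Relation.Binary.Pointwise.NonDependent using (Pointwise)
open import Data.Sum using (inj₁; inj₂)
open import Function using (_∘_; id)
open import Relation.Binary using (Rel; IsDecTotalOrder; Decidable; Transitive; Antisymmetric)
open import Relation.Binary.PropositionalEquality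
  using ( _≡_; _≢_; refl; sym; trans; cong; cong₂; subst; subst₂; isEquivalence; resp₂
        ; module ≡-Reasoning )
open import Relation.Nullary using (¬_; Dec; yes; no; does; contradiction)
open import Relation.Nullary.Decidable using (_×-dec_; ¬?)
open import Relation.Unary using (Pred; _⊆_; _≐_; ∁; _∩_) renaming (Decidable to Decidable₁)
open import Relation.Unary.Properties using (U?; ∁?; _∩?_)

private
  variable
    p q ℓ : Level
    a n : ℕ

count : {P : Pred (Fin n) p} → Decidable₁ P → ℕ
count {n = zero}  P? = 0
count {n = suc n} P? = (if does (P? zero) then 1 else 0) + count (P? ∘ suc)

length-filter-tabulate : {A : Set} {P : Pred A p} (P? : Decidable₁ P) (h : Fin n → A) →
                         length (filter P? (tabulate h)) ≡ count (P? ∘ h)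
length-filter-tabulate {n = zero}  P? h = refl
length-filter-tabulate {n = suc n} P? h with does (P? (h zero))
... | true  = cong suc (length-filter-tabulate P? (h ∘ suc))
... | false = length-filter-tabulate P? (h ∘ suc)

count-none : {P : Pred (Fin n) p} (P? : Decidable₁ P) → (∀ x → ¬ P x) → count P? ≡ 0
count-none {n = zero}  P? ¬P = refl
count-none {n = suc n} P? ¬P with P? zero
... | yes P0 = contradiction P0 (¬P zero)
... | no  _  = count-none (P? ∘ suc) (¬P ∘ suc)

count-all : {P : Pred (Fin n) p} (P? : Decidable₁ P) → (∀ x → P x) → count P? ≡ n
count-all {n = zero}  P? P = refl
count-all {n = suc n} P? P with P? zero
... | yes _   = cong suc (count-all (P? ∘ suc) (P ∘ suc))
... | no  ¬P0 = contradiction (P zero) ¬P0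

count≤n : {P : Pred (Fin n) p} (P? : Decidable₁ P) → count P? ≤ n
count≤n {n = zero}  P? = z≤n
count≤n {n = suc n} P? with does (P? zero)
... | true  = s≤s (count≤n (P? ∘ suc))
... | false = ℕ.m≤n⇒m≤1+n (count≤n (P? ∘ suc))

count-pos : {P : Pred (Fin n) p} (P? : Decidable₁ P) {x : Fin n} → P x → 0 < count P?
count-pos P? {zero} P0 with P? zero
... | yes _   = z<s
... | no  ¬P0 = contradiction P0 ¬P0
count-pos P? {suc x} Px = ≤-trans (count-pos (P? ∘ suc) Px) (m≤n+m _ _)

count-mono : {P : Pred (Fin n) p} {Q : Pred (Fin n) q} (P? : Decidable₁ P) (Q? : Decidable₁ Q) →
             P ⊆ Q → count P? ≤ count Q?
count-mono {n = zero}  P? Q? P⊆Q = z≤n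
count-mono {n = suc n} P? Q? P⊆Q with P? zero | Q? zero
... | yes P0 | no ¬Q0 = contradiction (P⊆Q P0) ¬Q0
... | yes _  | yes _  = s≤s (count-mono (P? ∘ suc) (Q? ∘ suc) P⊆Q)
... | no _   | yes _  = ℕ.m≤n⇒m≤1+n (count-mono (P? ∘ suc) (Q? ∘ suc) P⊆Q)
... | no _   | no _   = count-mono (P? ∘ suc) (Q? ∘ suc) P⊆Q

count-strictMono : {P : Pred (Fin n) p} {Q : Pred (Fin n) q} (P? : Decidable₁ P) (Q? : Decidable₁ Q) →
                   P ⊆ Q → ∀ {x} → Q x → ¬ P x → count P? < count Q?
count-strictMono P? Q? P⊆Q {zero} Q0 ¬P0 with P? zero | Q? zero
... | yes P0 | _      = contradiction P0 ¬P0
... | no _   | no ¬Q0 = contradiction Q0 ¬Q0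
... | no _   | yes _  = s≤s (count-mono (P? ∘ suc) (Q? ∘ suc) P⊆Q)
count-strictMono P? Q? P⊆Q {suc x} Qx ¬Px with P? zero | Q? zero
... | yes P0 | no ¬Q0 = contradiction (P⊆Q P0) ¬Q0
... | yes _  | yes _  = s≤s (count-strictMono (P? ∘ suc) (Q? ∘ suc) P⊆Q Qx ¬Px)
... | no _   | yes _  = ℕ.m<n⇒m<1+n (count-strictMono (P? ∘ suc) (Q? ∘ suc) P⊆Q Qx ¬Px)
... | no _   | no _   = count-strictMono (P? ∘ suc) (Q? ∘ suc) P⊆Q Qx ¬Px

count-cong : {P : Pred (Fin n) p} {Q : Pred (Fin n) q} (P? : Decidable₁ P) (Q? : Decidable₁ Q) →
             P ≐ Q → count P? ≡ count Q?
count-cong P? Q? (P⊆Q , Q⊆P) = ≤-antisym (count-mono P? Q? P⊆Q) (count-mono Q? P? Q⊆P)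

count-partition : {P : Pred (Fin n) p} {Q : Pred (Fin n) q} (P? : Decidable₁ P) (Q? : Decidable₁ Q) →
                  count (P? ∩? Q?) + count (P? ∩? ∁? Q?) ≡ count P?
count-partition {n = zero}  P? Q? = refl
count-partition {n = suc n} P? Q? with P? zero | Q? zero
... | yes _ | yes _ = cong suc (count-partition (P? ∘ suc) (Q? ∘ suc))
... | yes _ | no _  = trans (+-suc _ _) (cong suc (count-partition (P? ∘ suc) (Q? ∘ suc)))
... | no _  | _     = count-partition (P? ∘ suc) (Q? ∘ suc)

count-single : {P : Pred (Fin n) p} (P? : Decidable₁ P) (x : Fin n) →
               count (P? ∩? (x ≟_)) ≡ (if does (P? x) then 1 else 0)
count-single {n = suc n} P? zero with P? zero
... | yes _ = cong suc (count-none {n = n} _ (λ _ → 0≢1+n ∘ proj₂))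
... | no _  = count-none {n = n} _ (λ _ → 0≢1+n ∘ proj₂)
count-single {n = suc n} {P = P} P? (suc x) = begin
  count (P? ∩? (suc x ≟_))
    ≡⟨ cong₂ _+_ (cong (λ b → if b then 1 else 0) (∧-zeroʳ (does (P? zero))))
                 (count-cong {n = n} _ ((P? ∘ suc) ∩? (x ≟_)) suc-shift) ⟩
  count ((P? ∘ suc) ∩? (x ≟_))
    ≡⟨ count-single (P? ∘ suc) x ⟩
  (if does (P? (suc x)) then 1 else 0) ∎
  where
  open ≡-Reasoning
  suc-shift : (λ k → P (suc k) × suc x ≡ suc k) ≐ (λ k → P (suc k) × x ≡ k)
  suc-shift = (λ (Pk , e) → Pk , Fin.suc-injective e) , (λ (Pk , e) → Pk , cong suc e)

count-toℕ≤ : ∀ m → m < n → count (λ (k : Fin n) → toℕ k ≤? m) ≡ suc m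
count-toℕ≤ {n = suc n} zero    _         = cong suc (count-none {n = n} _ (λ _ ()))
count-toℕ≤ {n = suc n} (suc m) (s≤s m<n) =
  cong suc (trans (count-cong {n = n} _ _ (s≤s⁻¹ , s≤s)) (count-toℕ≤ m m<n))

InImage? : (f : Fin a → Fin n) → Decidable₁ (InImage f)
InImage? f k = any? (λ j → f j ≟ k)

count-image : {f : Fin a → Fin n} → InjectiveMap f → {P : Pred (Fin n) p} (P? : Decidable₁ P) →
              count (P? ∩? InImage? f) ≡ count (P? ∘ f)
count-image {a = zero}  {n = n} f-inj P? = count-none {n = n} _ (λ { _ (_ , () , _) })
count-image {a = suc a} {n = n} {f = f} f-inj {P = P} P? = begin
  count (P? ∩? InImage? f)
    ≡⟨ count-partition (P? ∩? InImage? f) (f zero ≟_) ⟨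
  count ((P? ∩? InImage? f) ∩? (f zero ≟_)) + count ((P? ∩? InImage? f) ∩? ∁? (f zero ≟_))
    ≡⟨ cong₂ _+_ (count-cong _ (P? ∩? (f zero ≟_)) at-f0)
                 (count-cong _ (P? ∩? InImage? (f ∘ suc)) off-f0) ⟩
  count (P? ∩? (f zero ≟_)) + count (P? ∩? InImage? (f ∘ suc))
    ≡⟨ cong₂ _+_ (count-single P? (f zero)) (count-image f∘suc-inj P?) ⟩
  count (P? ∘ f) ∎
  where
  open ≡-Reasoning
  f∘suc-inj : InjectiveMap (f ∘ suc)
  f∘suc-inj i j = Fin.suc-injective ∘ f-inj (suc i) (suc j)
  at-f0 : (P ∩ InImage f) ∩ (f zero ≡_) ≐ P ∩ (f zero ≡_)
  at-f0 = (λ ((Pk , _) , f0≡k) → Pk , f0≡k) , (λ (Pk , f0≡k) → (Pk , zero , f0≡k) , f0≡k)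
  off-f0 : (P ∩ InImage f) ∩ ∁ (f zero ≡_) ≐ P ∩ InImage (f ∘ suc)
  proj₁ off-f0 ((Pk , zero  , f0≡k) , f0≢k) = contradiction f0≡k f0≢k
  proj₁ off-f0 ((Pk , suc j , fj≡k) , _)    = Pk , j , fj≡k
  proj₂ off-f0 (Pk , j , fj≡k) =
    (Pk , suc j , fj≡k) , λ f0≡k → 0≢1+n (f-inj zero (suc j) (trans f0≡k (sym fj≡k)))

count-∁image : {f : Fin a → Fin n} → InjectiveMap f → a + count (∁? (InImage? f)) ≡ n
count-∁image {a = a} {n = n} {f = f} f-inj = begin
  a + count (∁? (InImage? f))
    ≡⟨ cong₂ _+_ (sym (trans (count-image f-inj U?) (count-all (U? ∘ f) _)))
                 (count-cong (∁? (InImage? f)) (U? ∩? ∁? (InImage? f)) ((_ ,_) , proj₂)) ⟩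
  count (U? ∩? InImage? f) + count (U? ∩? ∁? (InImage? f))
    ≡⟨ count-partition U? (InImage? f) ⟩
  count {n = n} U?
    ≡⟨ count-all U? _ ⟩
  n ∎
  where open ≡-Reasoning

Gaps : (f : Fin a → Fin n) → Fin a → Pred (Fin n) 0ℓ
Gaps f i k = toℕ k ≤ toℕ (f i) × ¬ InImage f k

Gaps? : (f : Fin a → Fin n) (i : Fin a) → Decidable₁ (Gaps f i)
Gaps? f i k = (toℕ k ≤? toℕ (f i)) ×-dec ¬? (InImage? f k)

gMap≡count-Gaps : (f : Fin a → Fin n) (i : Fin a) → gMap f i ≡ count (Gaps? f i)
gMap≡count-Gaps f i = length-filter-tabulate (Gaps? f i) id

gMap≤b : ∀ b (f : Fin a → Fin (a + b)) → InjectiveMap f → ∀ i → gMap f i ≤ b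
gMap≤b {a = a} b f f-inj i = begin
  gMap f i                 ≡⟨ gMap≡count-Gaps f i ⟩
  count (Gaps? f i)        ≤⟨ count-mono (Gaps? f i) (∁? (InImage? f)) proj₂ ⟩
  count (∁? (InImage? f))  ≡⟨ +-cancelˡ-≡ a _ _ (count-∁image f-inj) ⟩
  b                        ∎
  where open ℕ.≤-Reasoning

Gaps-mono : (f : Fin a → Fin n) {i j : Fin a} → toℕ (f j) ≤ toℕ (f i) → Gaps f j ⊆ Gaps f i
Gaps-mono f fj≤fi (k≤fj , k∉f) = ≤-trans k≤fj fj≤fi , k∉f

gMap-mono : (f : Fin a → Fin n) {i j : Fin a} → toℕ (f j) ≤ toℕ (f i) → gMap f j ≤ gMap f i
gMap-mono f {i} {j} fj≤fi =
  subst₂ _≤_ (sym (gMap≡count-Gaps f j)) (sym (gMap≡count-Gaps f i))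
    (count-mono (Gaps? f j) (Gaps? f i) (Gaps-mono f fj≤fi))

gMap-strictMono : (f : Fin a → Fin n) {i j : Fin a} {k : Fin n} →
                  toℕ (f j) < toℕ k → toℕ k ≤ toℕ (f i) → ¬ InImage f k → gMap f j < gMap f i
gMap-strictMono f {i} {j} fj<k k≤fi k∉f =
  subst₂ _<_ (sym (gMap≡count-Gaps f j)) (sym (gMap≡count-Gaps f i))
    (count-strictMono (Gaps? f j) (Gaps? f i) (Gaps-mono f (<⇒≤ (<-≤-trans fj<k k≤fi)))
                      (k≤fi , k∉f) (<⇒≱ fj<k ∘ proj₁))

suc-toℕ≡gMap+count : (f : Fin a → Fin n) → InjectiveMap f → ∀ i →
                     suc (toℕ (f i)) ≡ gMap f i + count (λ j → toℕ (f j) ≤? toℕ (f i))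
suc-toℕ≡gMap+count f f-inj i = begin
  suc (toℕ (f i))
    ≡⟨ count-toℕ≤ (toℕ (f i)) (toℕ<n (f i)) ⟨
  count Below?
    ≡⟨ count-partition Below? (InImage? f) ⟨
  count (Below? ∩? InImage? f) + count (Gaps? f i)
    ≡⟨ +-comm (count (Below? ∩? InImage? f)) _ ⟩
  count (Gaps? f i) + count (Below? ∩? InImage? f)
    ≡⟨ cong₂ _+_ (sym (gMap≡count-Gaps f i)) (count-image f-inj Below?) ⟩
  gMap f i + count (λ j → toℕ (f j) ≤? toℕ (f i)) ∎
  where
  open ≡-Reasoning
  Below? : Decidable₁ (λ k → toℕ k ≤ toℕ (f i))
  Below? k = toℕ k ≤? toℕ (f i)

-- The value m = f(i) − 1 cannot be a gap, since it would separate g_f(j) from g_f(i);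
-- so m = f(l), and the induction hypothesis for l together with no ascent from l to i
-- give j < l < i.
gMap-plateau⇒toℕ< : {f : Fin a → Fin n} → NoAscentCondition f → ∀ d {i j} →
                    toℕ (f i) ≡ d + suc (toℕ (f j)) → gMap f j ≡ gMap f i → toℕ j < toℕ i
gMap-plateau⇒toℕ< f-noAscent zero {i} {j} fi≡1+fj _ = f-noAscent i j fi≡1+fj
gMap-plateau⇒toℕ< {n = n} {f = f} f-noAscent (suc d) {i} {j} fi≡1+m gj≡gi = by-cases (InImage? f k)
  where
  m : ℕ
  m = d + suc (toℕ (f j))
  fj<m : toℕ (f j) < m
  fj<m = m≤n+m (suc (toℕ (f j))) d
  m≤fi : m ≤ toℕ (f i)
  m≤fi = ≤-trans (n≤1+n m) (≤-reflexive (sym fi≡1+m))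
  m<n : m < n
  m<n = ≤-<-trans m≤fi (toℕ<n (f i))
  k : Fin n
  k = fromℕ< m<n
  by-cases : Dec (InImage f k) → toℕ j < toℕ i
  by-cases (no k∉f) = contradiction gj≡gi (<⇒≢ (gMap-strictMono f fj<k k≤fi k∉f))
    where
    fj<k : toℕ (f j) < toℕ k
    fj<k = subst (toℕ (f j) <_) (sym (toℕ-fromℕ< m<n)) fj<m
    k≤fi : toℕ k ≤ toℕ (f i)
    k≤fi = subst (_≤ toℕ (f i)) (sym (toℕ-fromℕ< m<n)) m≤fi
  by-cases (yes (l , fl≡k)) =
    <-trans (gMap-plateau⇒toℕ< f-noAscent d fl≡m gj≡gl)
            (f-noAscent i l (trans fi≡1+m (cong suc (sym fl≡m))))
    where
    fl≡m : toℕ (f l) ≡ m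
    fl≡m = trans (cong toℕ fl≡k) (toℕ-fromℕ< m<n)
    gj≡gl : gMap f j ≡ gMap f l
    gj≡gl = ≤-antisym (gMap-mono f (subst (toℕ (f j) ≤_) (sym fl≡m) (<⇒≤ fj<m)))
                      (≤-trans (gMap-mono f (subst (_≤ toℕ (f i)) (sym fl≡m) m≤fi))
                               (≤-reflexive (sym gj≡gi)))

module _ {A : Set} {_≼_ : Rel A ℓ} (≼-isDecTotalOrder : IsDecTotalOrder _≡_ _≼_) {φ : A → ℕ} where
  open IsDecTotalOrder ≼-isDecTotalOrder using () renaming
    (antisym to ≼-antisym; total to ≼-total; reflexive to ≼-reflexive; _≟_ to _≟ᴬ_)

  <-reflecting⇒mono : (∀ {x y} → φ x < φ y → x ≼ y) → ∀ {x y} → x ≼ y → φ x ≤ φ y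
  <-reflecting⇒mono reflects x≼y =
    ≮⇒≥ λ φy<φx → <-irrefl (cong φ (≼-antisym (reflects φy<φx) x≼y)) φy<φx

  module _ (strictMono : ∀ {x y} → x ≼ y → x ≢ y → φ x < φ y) where

    strictMono⇒≤-reflecting : ∀ {x y} → φ x ≤ φ y → x ≼ y
    strictMono⇒≤-reflecting {x} {y} φx≤φy with ≼-total x y | y ≟ᴬ x
    ... | inj₁ x≼y | _        = x≼y
    ... | inj₂ _   | yes refl = ≼-reflexive refl
    ... | inj₂ y≼x | no y≢x   = contradiction (strictMono y≼x y≢x) (≤⇒≯ φx≤φy)

    strictMono⇒injective : ∀ {x y} → φ x ≡ φ y → x ≡ y
    strictMono⇒injective {x} {y} φx≡φy with ≼-total x y | x ≟ᴬ y
    ... | _        | yes x≡y = x≡y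
    ... | inj₁ x≼y | no x≢y  = contradiction φx≡φy (<⇒≢ (strictMono x≼y x≢y))
    ... | inj₂ y≼x | no x≢y  = contradiction (sym φx≡φy) (<⇒≢ (strictMono y≼x (x≢y ∘ sym)))

rank : {_≼_ : Rel (Fin a) ℓ} → Decidable _≼_ → Fin a → ℕ
rank _≼?_ i = count (_≼? i)

module _ {_≼_ : Rel (Fin a) ℓ} (≼-isDecTotalOrder : IsDecTotalOrder _≡_ _≼_) where
  open IsDecTotalOrder ≼-isDecTotalOrder using () renaming
    (antisym to ≼-antisym; trans to ≼-trans; reflexive to ≼-reflexive; _≤?_ to _≼?_)

  rank-mono : ∀ {i j} → j ≼ i → rank _≼?_ j ≤ rank _≼?_ i
  rank-mono j≼i = count-mono (_≼? _) (_≼? _) (λ k≼j → ≼-trans k≼j j≼i)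

  rank-strictMono : ∀ {i j} → j ≼ i → j ≢ i → rank _≼?_ j < rank _≼?_ i
  rank-strictMono j≼i j≢i =
    count-strictMono (_≼? _) (_≼? _) (λ k≼j → ≼-trans k≼j j≼i)
                     (≼-reflexive refl) (j≢i ∘ ≼-antisym j≼i)

  rank-pos : ∀ i → 0 < rank _≼?_ i
  rank-pos i = count-pos (_≼? i) (≼-reflexive refl)

infix 4 _≤lex[_]_

key : (Fin a → ℕ) → Fin a → ℕ × ℕ
key g i = g i , toℕ i

_≤ₗₑₓ_ : Rel (ℕ × ℕ) 0ℓ
_≤ₗₑₓ_ = ×-Lex _≡_ _<_ _≤_

_≤lex[_]_ : Fin a → (Fin a → ℕ) → Fin a → Set
j ≤lex[ g ] i = key g j ≤ₗₑₓ key g i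

≤ₗₑₓ-trans : Transitive _≤ₗₑₓ_
≤ₗₑₓ-trans = ×-transitive {_<₁_ = _<_} {_<₂_ = _≤_} isEquivalence (resp₂ _<_) <-trans ≤-trans

≤ₗₑₓ-antisym : Antisymmetric (Pointwise _≡_ _≡_) _≤ₗₑₓ_
≤ₗₑₓ-antisym = ×-antisymmetric {_<₁_ = _<_} {_<₂_ = _≤_} sym <-irrefl <-asym ≤-antisym

≤lex-isDecTotalOrder : (g : Fin a → ℕ) → IsDecTotalOrder _≡_ (_≤lex[ g ]_)
≤lex-isDecTotalOrder g = record
  { isTotalOrder = record
    { isPartialOrder = record
      { isPreorder = record
        { isEquivalence = isEquivalence
        ; reflexive     = λ { refl → inj₂ (refl , ≤-refl) }
        ; trans         = ≤ₗₑₓ-trans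
        }
      ; antisym = λ j≤i i≤j → toℕ-injective (proj₂ (≤ₗₑₓ-antisym j≤i i≤j))
      }
    ; total = λ j i → ×-total₂ sym <-cmp ≤-total (key g j) (key g i)
    }
  ; _≟_  = _≟_
  ; _≤?_ = λ j i → ×-decidable ℕ._≟_ _<?_ _≤?_ (key g j) (key g i)
  }

module ≤lex {a} (g : Fin a → ℕ) = IsDecTotalOrder (≤lex-isDecTotalOrder g)

≤lex⇒≤ : {g : Fin a → ℕ} {i j : Fin a} → j ≤lex[ g ] i → g j ≤ g i
≤lex⇒≤ (inj₁ gj<gi)       = <⇒≤ gj<gi
≤lex⇒≤ (inj₂ (gj≡gi , _)) = ≤-reflexive gj≡gi

lexRank : (Fin a → ℕ) → Fin a → ℕ
lexRank g = rank (≤lex._≤?_ g)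

lexRank-cong : {g h : Fin a → ℕ} → (∀ i → g i ≡ h i) → ∀ i → lexRank g i ≡ lexRank h i
lexRank-cong {g = g} {h} g≗h i =
  count-cong (λ j → ≤lex._≤?_ g j i) (λ j → ≤lex._≤?_ h j i)
             (transport g≗h , transport (sym ∘ g≗h))
  where
  transport : {g h : Fin _ → ℕ} → (∀ i → g i ≡ h i) → ∀ {j} → j ≤lex[ g ] i → j ≤lex[ h ] i
  transport g≗h = subst₂ _≤ₗₑₓ_ (cong (_, _) (g≗h _)) (cong (_, _) (g≗h _))

module _ {f : Fin a → Fin n} (f-inj : InjectiveMap f) (f-noAscent : NoAscentCondition f) where

  ≤⇒≤lex-gMap : ∀ {i j} → toℕ (f j) ≤ toℕ (f i) → j ≤lex[ gMap f ] i
  ≤⇒≤lex-gMap {i} {j} fj≤fi with m≤n⇒m<n∨m≡n fj≤fi | gMap f j ℕ.≟ gMap f i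
  ... | inj₂ fj≡fi | _         = ≤lex.reflexive (gMap f) (f-inj j i (toℕ-injective fj≡fi))
  ... | inj₁ _     | no gj≢gi  = inj₁ (≤∧≢⇒< (gMap-mono f fj≤fi) gj≢gi)
  ... | inj₁ fj<fi | yes gj≡gi =
    let d , 1+fj+d≡fi = m≤n⇒∃[o]m+o≡n fj<fi
        fi≡d+1+fj     = trans (sym 1+fj+d≡fi) (+-comm _ d)
    in inj₂ (gj≡gi , <⇒≤ (gMap-plateau⇒toℕ< f-noAscent d fi≡d+1+fj gj≡gi))

  ≤lex-gMap⇒≤ : ∀ {i j} → j ≤lex[ gMap f ] i → toℕ (f j) ≤ toℕ (f i)
  ≤lex-gMap⇒≤ = <-reflecting⇒mono (≤lex-isDecTotalOrder (gMap f)) (≤⇒≤lex-gMap ∘ <⇒≤)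

  suc-toℕ≡gMap+lexRank : ∀ i → suc (toℕ (f i)) ≡ gMap f i + lexRank (gMap f) i
  suc-toℕ≡gMap+lexRank i = trans (suc-toℕ≡gMap+count f f-inj i)
    (cong (gMap f i +_)
          (count-cong _ (λ j → ≤lex._≤?_ (gMap f) j i) (≤⇒≤lex-gMap , ≤lex-gMap⇒≤)))

gMap-determines : {f f′ : Fin a → Fin n} →
                  InjectiveMap f → NoAscentCondition f → InjectiveMap f′ → NoAscentCondition f′ →
                  (∀ i → gMap f i ≡ gMap f′ i) → ∀ i → f i ≡ f′ i
gMap-determines {f = f} {f′} f-inj f-noAscent f′-inj f′-noAscent g≗g′ i =
  toℕ-injective (suc-injective (begin
    suc (toℕ (f i))                  ≡⟨ suc-toℕ≡gMap+lexRank f-inj f-noAscent i ⟩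
    gMap f i + lexRank (gMap f) i     ≡⟨ cong₂ _+_ (g≗g′ i) (lexRank-cong g≗g′ i) ⟩
    gMap f′ i + lexRank (gMap f′) i   ≡⟨ suc-toℕ≡gMap+lexRank f′-inj f′-noAscent i ⟨
    suc (toℕ (f′ i))                 ∎))
  where open ≡-Reasoning

module Construction {a b} (g : Fin a → Fin (suc b)) where
  private
    h : Fin a → ℕ
    h = toℕ ∘ g

  position : Fin a → ℕ
  position i = pred (h i + lexRank h i)

  suc-position : ∀ i → suc (position i) ≡ h i + lexRank h i
  suc-position i =
    suc-pred _ {{>-nonZero (≤-trans (rank-pos (≤lex-isDecTotalOrder h) i) (m≤n+m _ (h i)))}}

  position<a+b : ∀ i → position i < a + b
  position<a+b i = begin
    suc (position i)   ≡⟨ suc-position i ⟩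
    h i + lexRank h i  ≤⟨ +-mono-≤ (s≤s⁻¹ (toℕ<n (g i))) (count≤n _) ⟩
    b + a              ≡⟨ +-comm b a ⟩
    a + b              ∎
    where open ℕ.≤-Reasoning

  f : Fin a → Fin (a + b)
  f i = fromℕ< (position<a+b i)

  suc-toℕ-f : ∀ i → suc (toℕ (f i)) ≡ h i + lexRank h i
  suc-toℕ-f i = trans (cong suc (toℕ-fromℕ< (position<a+b i))) (suc-position i)

  f-mono : ∀ {i j} → j ≤lex[ h ] i → toℕ (f j) ≤ toℕ (f i)
  f-mono {i} {j} j≤i = s≤s⁻¹ (subst₂ _≤_ (sym (suc-toℕ-f j)) (sym (suc-toℕ-f i))
    (+-mono-≤ (≤lex⇒≤ j≤i) (rank-mono (≤lex-isDecTotalOrder h) j≤i)))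

  f-strictMono : ∀ {i j} → j ≤lex[ h ] i → j ≢ i → toℕ (f j) < toℕ (f i)
  f-strictMono {i} {j} j≤i j≢i = s≤s⁻¹ (subst₂ _<_ (sym (suc-toℕ-f j)) (sym (suc-toℕ-f i))
    (+-mono-≤-< (≤lex⇒≤ j≤i) (rank-strictMono (≤lex-isDecTotalOrder h) j≤i j≢i)))

  ≤⇒≤lex : ∀ {i j} → toℕ (f j) ≤ toℕ (f i) → j ≤lex[ h ] i
  ≤⇒≤lex = strictMono⇒≤-reflecting (≤lex-isDecTotalOrder h) f-strictMono

  f-injective : InjectiveMap f
  f-injective i j = strictMono⇒injective (≤lex-isDecTotalOrder h) f-strictMono ∘ cong toℕ

  f-noAscent : NoAscentCondition f
  f-noAscent i j fi≡1+fj with ≤⇒≤lex (≤-trans (n≤1+n _) (≤-reflexive (sym fi≡1+fj)))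
  ... | inj₂ (_ , j≤i) = ≤∧≢⇒< j≤i (i≢j ∘ sym ∘ toℕ-injective)
    where
    i≢j : i ≢ j
    i≢j refl = 1+n≰n (≤-reflexive (sym fi≡1+fj))
  ... | inj₁ hj<hi = contradiction two-apart 1+n≰n
    where
    open ℕ.≤-Reasoning
    j≢i : j ≢ i
    j≢i refl = <-irrefl refl hj<hi
    rj<ri : lexRank h j < lexRank h i
    rj<ri = rank-strictMono (≤lex-isDecTotalOrder h) (inj₁ hj<hi) j≢i
    two-apart : suc (suc (h j + lexRank h j)) ≤ suc (h j + lexRank h j)
    two-apart = begin
      suc (suc (h j + lexRank h j))  ≡⟨ cong suc (+-suc (h j) (lexRank h j)) ⟨
      suc (h j) + suc (lexRank h j)  ≤⟨ +-mono-≤ hj<hi rj<ri ⟩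
      h i + lexRank h i              ≡⟨ suc-toℕ-f i ⟨
      suc (toℕ (f i))                ≡⟨ cong suc fi≡1+fj ⟩
      suc (suc (toℕ (f j)))          ≡⟨ cong suc (suc-toℕ-f j) ⟩
      suc (h j + lexRank h j)        ∎

  gMap-f : ∀ i → gMap f i ≡ h i
  gMap-f i = +-cancelʳ-≡ (lexRank h i) _ _ (begin
    gMap f i + lexRank h i
      ≡⟨ cong (gMap f i +_) (count-cong (λ j → ≤lex._≤?_ h j i) _ (f-mono , ≤⇒≤lex)) ⟩
    gMap f i + count (λ j → toℕ (f j) ≤? toℕ (f i))
      ≡⟨ suc-toℕ≡gMap+count f f-injective i ⟨
    suc (toℕ (f i))
      ≡⟨ suc-toℕ-f i ⟩
    h i + lexRank h i ∎)
    where open ≡-Reasoning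

lemma2p1 : (a b : ℕ) →
    ((f : Fin a → Fin (a + b)) → InA a b f → ∀ i → gMap f i ≤ b)
    × ((f f′ : Fin a → Fin (a + b)) → InA a b f → InA a b f′ →
        (∀ i → gMap f i ≡ gMap f′ i) → ∀ i → f i ≡ f′ i)
    × ((g : Fin a → Fin (suc b)) →
        ∃ λ (f : Fin a → Fin (a + b)) → InA a b f × (∀ i → gMap f i ≡ toℕ (g i)))
lemma2p1 a b =
    (λ f (f-inj , _) → gMap≤b b f f-inj)
  , (λ f f′ (f-inj , f-noAscent) (f′-inj , f′-noAscent) →
       gMap-determines f-inj f-noAscent f′-inj f′-noAscent)
  , λ g → let open Construction g in f , (f-injective , f-noAscent) , gMap-f
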